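{- Let $(a_n)_{n\ge1}$ be the Kentucky-2 sequence. Then $a_1=1$, $a_2=2$, $a_3=3$, $a_4=4$ and $a_{n+1}=a_{n-1}+2a_{n-3}$ for all $n\ge 4$. Consequently, for all $n\ge1$, \[ a_{2n}=2^n \qquad\text{and}\qquad a_{2n-1}=\tfrac13\left(2^{n+1}+(-1)^n\right). \]
   Context: The Kentucky-2 sequence $(a_n)_{n\ge1}$ is defined as follows. The index $\ell$ (and the term $a_\ell$) belongs to bin number $\lceil \ell/2\rceil$, so the $k$-th bin is $b_k=\{a_{2k-1},a_{2k}\}$. A legal decomposition of an integer $m\ge0$ using terms from $\{a_1,\dots,a_N\}$ is an expression $m=a_{\ell_1}+\cdots+a_{\ell_k}$ with $k\ge0$ and $1\le\ell_1<\cdots<\ell_k\le N$ such that no two summands lie in the same bin or in two consecutive bins, i.e. $\lceil \ell_{j+1}/2\rceil-\lceil \ell_j/2\rceil\ge2$ for all $j$. The sequence is built greedily: $a_1=1$, and for $N\ge1$, $a_{N+1}$ is the smallest positive integer having no legal decomposition using terms from $\{a_1,\dots,a_N\}$. (Its first terms are $1,2,3,4,5,8,11,16,21,32,\dots$.) -}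

module Defs where

open import Data.Nat using (ℕ; zero; suc; _+_; _*_; _≤_; _<_; _/_)
open import Data.List using (List; map)
open import Data.Nat.ListAction using (sum)
open import Data.List.Relation.Unary.All using (All)
open import Data.List.Relation.Unary.Linked using (Linked)
open import Data.Product using (_×_; ∃-syntax)
open import Relation.Binary.PropositionalEquality using (_≡_)
open import Relation.Nullary using (¬_)

-- Sequences are functions ℕ → ℕ indexed from 1 (the value at 0 is irrelevant).

-- bin number of index ℓ ≥ 1 :  ⌈ ℓ / 2 ⌉ = (ℓ + 1) / 2
bin : ℕ → ℕ
bin ℓ = (ℓ + 1) / 2

Separated : ℕ → ℕ → Set
Separated ℓ ℓ' = ℓ < ℓ' × bin ℓ + 2 ≤ bin ℓ'

LegalIndices : ℕ → List ℕ → Set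
LegalIndices N ls = All (λ ℓ → 1 ≤ ℓ × ℓ ≤ N) ls × Linked Separated ls

HasLegalDecomp : (ℕ → ℕ) → ℕ → ℕ → Set
HasLegalDecomp a N m = ∃[ ls ] (LegalIndices N ls × sum (map a ls) ≡ m)

IsKentucky2 : (ℕ → ℕ) → Set
IsKentucky2 a =
  a 1 ≡ 1 ×
  (∀ N → 1 ≤ N →
     1 ≤ a (suc N) ×
     ¬ HasLegalDecomp a N (a (suc N)) ×
     (∀ m → 1 ≤ m → m < a (suc N) → HasLegalDecomp a N m))

module Submission where

-- The Kentucky-2 sequence is identified with an explicit sequence `kentucky`
-- defined by its increments: a_{ℓ+1} = a_ℓ + gap ℓ, where gap ℓ = oddTerm (bin ℓ ∸ 1)
-- and oddTerm k (= a_{2k-1} for k ≥ 1) satisfies oddTerm (k+2) = 2^{k+1} + oddTerm k.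
-- Evaluating at even and odd indices gives a_{2j} = 2^j and a_{2j+1} = oddTerm (j+1),
-- from which the recurrence and the closed forms follow by arithmetic.
--
-- The heart of the proof is that `kentucky` satisfies the greedy rule:
--  * soundness: a legal decomposition using a_1..a_N sums to less than a_{N+1},
--    because a_{ℓ+1} is at most the gap after any index two bins above ℓ;
--  * completeness: every m < a_{M+1} has a legal decomposition using a_1..a_M,
--    by greedily taking a_M and representing the remainder, which is smaller than
--    gap M = a_{L+1}, using the indices 1..L lying at least two bins below M.
-- Legal decompositions only depend on the first N terms, so an induction on N
-- shows that any sequence satisfying the greedy rule coincides with `kentucky`.

open import Defs
open import Data.Nat using (ℕ; zero; suc; _+_; _*_; _∸_; _^_; _≤_; _<_; _≤′_; ≤′-refl; ≤′-step; z≤n; s≤s; _<?_)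
open import Data.Nat.Properties
open import Data.Nat.DivMod using (m/n≡1+[m∸n]/n; /-monoˡ-≤)
open import Data.Nat.Induction using (<-rec)
open import Data.Nat.ListAction using (sum)
open import Data.Nat.ListAction.Properties using (sum-++)
open import Data.Nat.Solver using (module +-*-Solver)
open import Data.Integer using (+_; -1ℤ) renaming (_+_ to _+ℤ_; _^_ to _^ℤ_)
import Data.Integer.Properties as ℤ
open import Data.List using ([]; _∷_; map; _++_)
open import Data.List.Properties using (map-++)
open import Data.List.Relation.Unary.All as All using (All; []; _∷_)
import Data.List.Relation.Unary.All.Properties as All
open import Data.List.Relation.Unary.Linked using (Linked; []; [-]; _∷_)
open import Data.Product using (_×_; _,_; proj₁)
open import Data.Sum using (inj₁; inj₂)
open import Data.Empty using (⊥-elim)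
open import Relation.Nullary using (¬_; yes; no)
open import Relation.Binary using (tri<; tri≈; tri>)
open import Relation.Binary.PropositionalEquality

dbl : ℕ → ℕ
dbl zero    = zero
dbl (suc j) = suc (suc (dbl j))

dbl≡2* : ∀ j → dbl j ≡ 2 * j
dbl≡2* zero    = refl
dbl≡2* (suc j) = trans (cong (λ k → 2 + k) (dbl≡2* j)) (sym (*-distribˡ-+ 2 1 j))

data Parity : ℕ → Set where
  even : ∀ j → Parity (dbl j)
  odd  : ∀ j → Parity (suc (dbl j))

parity : ∀ n → Parity n
parity zero = even zero
parity (suc n) with parity n
... | even j = odd j
... | odd j  = even (suc j)

monotone-by-steps : (g : ℕ → ℕ) → (∀ k → g k ≤ g (suc k)) → ∀ {m n} → m ≤ n → g m ≤ g n
monotone-by-steps g step m≤n = go (≤⇒≤′ m≤n)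
  where
  go : ∀ {m n} → m ≤′ n → g m ≤ g n
  go ≤′-refl       = ≤-refl
  go (≤′-step m≤n) = ≤-trans (go m≤n) (step _)

bin-suc-suc : ∀ n → bin (suc (suc n)) ≡ suc (bin n)
bin-suc-suc n = m/n≡1+[m∸n]/n {suc (suc (n + 1))} {2} (s≤s (s≤s z≤n))

bin-even : ∀ j → bin (dbl j) ≡ j
bin-even zero    = refl
bin-even (suc j) = trans (bin-suc-suc (dbl j)) (cong suc (bin-even j))

bin-odd : ∀ j → bin (suc (dbl j)) ≡ suc j
bin-odd zero    = refl
bin-odd (suc j) = trans (bin-suc-suc (suc (dbl j))) (cong suc (bin-odd j))

bin-mono : ∀ {m n} → m ≤ n → bin m ≤ bin n
bin-mono m≤n = /-monoˡ-≤ 2 (+-monoˡ-≤ 1 m≤n)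

separated : ∀ {i ℓ} → bin i + 2 ≤ bin ℓ → Separated i ℓ
separated {i} {ℓ} far = ≰⇒> (λ ℓ≤i → <⇒≱ bin-i<bin-ℓ (bin-mono ℓ≤i)) , far
  where
  bin-i<bin-ℓ : bin i < bin ℓ
  bin-i<bin-ℓ = <-≤-trans (m<m+n (bin i) (s≤s z≤n)) far

-- lowerBlock ℓ is the last index lying at least two bins below ℓ (0 if there is none).
lowerBlock : ℕ → ℕ
lowerBlock ℓ = dbl (bin ℓ ∸ 2)

below-two-bins : ∀ B {i} → 1 ≤ i → i ≤ dbl (B ∸ 2) → bin i + 2 ≤ B
below-two-bins zero                1≤i i≤0 = ⊥-elim (<⇒≱ 1≤i i≤0)
below-two-bins (suc zero)          1≤i i≤0 = ⊥-elim (<⇒≱ 1≤i i≤0)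
below-two-bins (suc (suc b)) {i} _ i≤2b =
  ≤-trans (+-monoˡ-≤ 2 (≤-trans (bin-mono i≤2b) (≤-reflexive (bin-even b)))) (≤-reflexive (+-comm b 2))

lowerBlock-separated : ∀ ℓ {i} → 1 ≤ i → i ≤ lowerBlock ℓ → Separated i ℓ
lowerBlock-separated ℓ 1≤i i≤L = separated (below-two-bins (bin ℓ) 1≤i i≤L)

lowerBlock-< : ∀ ℓ → 1 ≤ ℓ → lowerBlock ℓ < ℓ
lowerBlock-< ℓ 1≤ℓ with lowerBlock ℓ in eq
... | zero  = 1≤ℓ
... | suc i = proj₁ (lowerBlock-separated ℓ (s≤s z≤n) (≤-reflexive (sym eq)))

-- The odd-indexed terms: oddTerm k = a_{2k-1} for k ≥ 1 (and oddTerm 0 = 1).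

oddTerm : ℕ → ℕ
oddTerm 0               = 1
oddTerm 1               = 1
oddTerm (suc (suc k))   = 2 ^ suc k + oddTerm k

oddTerm-step : ∀ k → oddTerm k ≤ oddTerm (suc k)
oddTerm-step 0             = ≤-refl
oddTerm-step 1             = s≤s z≤n
oddTerm-step (suc (suc k)) = +-mono-≤ (m≤m+n (2 ^ suc k) _) (oddTerm-step k)

oddTerm-mono : ∀ {m n} → m ≤ n → oddTerm m ≤ oddTerm n
oddTerm-mono = monotone-by-steps oddTerm oddTerm-step

oddTerm-pos : ∀ k → 1 ≤ oddTerm k
oddTerm-pos k = oddTerm-mono {0} {k} z≤n

oddTerm-sum : ∀ j → oddTerm (suc j) + oddTerm j ≡ 2 ^ suc j
oddTerm-sum zero    = refl
oddTerm-sum (suc j) = begin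
  (2 ^ suc j + oddTerm j) + oddTerm (suc j)  ≡⟨ +-assoc (2 ^ suc j) _ _ ⟩
  2 ^ suc j + (oddTerm j + oddTerm (suc j))  ≡⟨ cong (λ q → 2 ^ suc j + q) (+-comm (oddTerm j) _) ⟩
  2 ^ suc j + (oddTerm (suc j) + oddTerm j)  ≡⟨ cong (λ q → 2 ^ suc j + q) (oddTerm-sum j) ⟩
  2 ^ suc j + 2 ^ suc j                      ≡⟨ cong (λ q → 2 ^ suc j + q) (sym (+-identityʳ _)) ⟩
  2 ^ suc (suc j)                            ∎
  where open ≡-Reasoning

oddTerm-recurrence : ∀ j → oddTerm (3 + j) ≡ oddTerm (2 + j) + 2 * oddTerm (1 + j)
oddTerm-recurrence j = begin
  2 * 2 ^ suc j + x                  ≡⟨ cong (λ p → 2 * p + x) (sym (oddTerm-sum j)) ⟩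
  2 * (x + y) + x                    ≡⟨ solve 2 (λ x y → con 2 :* (x :+ y) :+ x
                                                  := ((x :+ y) :+ y) :+ con 2 :* x) refl x y ⟩
  ((x + y) + y) + 2 * x              ≡⟨ cong (λ p → (p + y) + 2 * x) (oddTerm-sum j) ⟩
  (2 ^ suc j + y) + 2 * x            ∎
  where
  open ≡-Reasoning
  open +-*-Solver
  x = oddTerm (suc j)
  y = oddTerm j

neg-one-pow-2+ : ∀ k → -1ℤ ^ℤ (2 + k) ≡ -1ℤ ^ℤ k
neg-one-pow-2+ k = trans (ℤ.^-distribˡ-+-* -1ℤ 2 k) (ℤ.*-identityˡ _)

oddTerm-closed : ∀ k → + (3 * oddTerm k) ≡ + (2 ^ suc k) +ℤ (-1ℤ ^ℤ k)
oddTerm-closed 0             = refl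
oddTerm-closed 1             = refl
oddTerm-closed (suc (suc k)) = begin
  + (3 * (P + oddTerm k))              ≡⟨ cong +_ (*-distribˡ-+ 3 P (oddTerm k)) ⟩
  + (3 * P + 3 * oddTerm k)            ≡⟨ ℤ.pos-+ (3 * P) (3 * oddTerm k) ⟩
  + (3 * P) +ℤ + (3 * oddTerm k)       ≡⟨ cong (+ (3 * P) +ℤ_) (oddTerm-closed k) ⟩
  + (3 * P) +ℤ (+ P +ℤ s)              ≡⟨ ℤ.+-assoc (+ (3 * P)) (+ P) s ⟨
  (+ (3 * P) +ℤ + P) +ℤ s              ≡⟨ cong (_+ℤ s) (ℤ.pos-+ (3 * P) P) ⟨
  + (3 * P + P) +ℤ s                   ≡⟨ cong (λ q → + q +ℤ s) (four-times P) ⟩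
  + (2 * (2 * P)) +ℤ s                 ≡⟨ cong (+ (2 * (2 * P)) +ℤ_) (neg-one-pow-2+ k) ⟨
  + (2 ^ suc (suc (suc k))) +ℤ (-1ℤ ^ℤ suc (suc k)) ∎
  where
  open ≡-Reasoning
  open +-*-Solver
  P = 2 ^ suc k
  s = -1ℤ ^ℤ k
  four-times : ∀ p → 3 * p + p ≡ 2 * (2 * p)
  four-times = solve 1 (λ p → con 3 :* p :+ p := con 2 :* (con 2 :* p)) refl

gap : ℕ → ℕ
gap ℓ = oddTerm (bin ℓ ∸ 1)

kentucky : ℕ → ℕ
kentucky zero    = zero
kentucky (suc ℓ) = kentucky ℓ + gap ℓ

kentucky-odd  : ∀ j → kentucky (suc (dbl j)) ≡ oddTerm (suc j)
kentucky-even : ∀ j → kentucky (dbl (suc j)) ≡ 2 ^ suc j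
kentucky-odd zero    = refl
kentucky-odd (suc j) =
  cong₂ _+_ (kentucky-even j) (cong (λ b → oddTerm (b ∸ 1)) (bin-even (suc j)))
kentucky-even j = begin
  kentucky (suc (dbl j)) + oddTerm (bin (suc (dbl j)) ∸ 1)
    ≡⟨ cong₂ _+_ (kentucky-odd j) (cong (λ b → oddTerm (b ∸ 1)) (bin-odd j)) ⟩
  oddTerm (suc j) + oddTerm j
    ≡⟨ oddTerm-sum j ⟩
  2 ^ suc j ∎
  where open ≡-Reasoning

kentucky-recurrence : ∀ m → kentucky (5 + m) ≡ kentucky (3 + m) + 2 * kentucky (1 + m)
kentucky-recurrence m with parity m
... | even j = begin
  kentucky (suc (dbl (2 + j)))                           ≡⟨ kentucky-odd (2 + j) ⟩
  oddTerm (3 + j)                                        ≡⟨ oddTerm-recurrence j ⟩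
  oddTerm (2 + j) + 2 * oddTerm (1 + j)                  ≡⟨ cong₂ (λ x y → x + 2 * y)
                                                              (kentucky-odd (1 + j)) (kentucky-odd j) ⟨
  kentucky (suc (dbl (1 + j))) + 2 * kentucky (suc (dbl j)) ∎
  where open ≡-Reasoning
... | odd j = begin
  kentucky (dbl (3 + j))                                 ≡⟨ kentucky-even (2 + j) ⟩
  2 ^ (3 + j)                                            ≡⟨ cong (λ q → 2 ^ (2 + j) + q) (+-identityʳ _) ⟩
  2 ^ (2 + j) + 2 * 2 ^ (1 + j)                          ≡⟨ cong₂ (λ x y → x + 2 * y)
                                                              (kentucky-even (1 + j)) (kentucky-even j) ⟨
  kentucky (dbl (2 + j)) + 2 * kentucky (dbl (1 + j))    ∎
  where open ≡-Reasoning

kentucky-mono : ∀ {m n} → m ≤ n → kentucky m ≤ kentucky n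
kentucky-mono = monotone-by-steps kentucky (λ ℓ → m≤m+n (kentucky ℓ) (gap ℓ))

kentucky-pos : ∀ ℓ → 1 ≤ kentucky (suc ℓ)
kentucky-pos ℓ = ≤-trans (oddTerm-pos (bin ℓ ∸ 1)) (m≤n+m (gap ℓ) (kentucky ℓ))

kentucky-suc-bound : ∀ ℓ → kentucky (suc ℓ) ≤ oddTerm (suc (bin ℓ))
kentucky-suc-bound ℓ with parity ℓ
... | even j rewrite kentucky-odd j  | bin-even j = ≤-refl
... | odd j  rewrite kentucky-even j | bin-odd j  = m≤m+n (2 ^ suc j) (oddTerm j)

kentucky-below-gap : ∀ {ℓ ℓ'} → bin ℓ + 2 ≤ bin ℓ' → kentucky (suc ℓ) ≤ gap ℓ'
kentucky-below-gap {ℓ} {ℓ'} far =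
  ≤-trans (kentucky-suc-bound ℓ) (oddTerm-mono (∸-monoˡ-≤ 1 (subst (_≤ bin ℓ') (+-comm (bin ℓ) 2) far)))

gap-lowerBlock-at : ∀ B → oddTerm (B ∸ 1) ≡ kentucky (suc (dbl (B ∸ 2)))
gap-lowerBlock-at zero          = refl
gap-lowerBlock-at (suc zero)    = refl
gap-lowerBlock-at (suc (suc b)) = sym (kentucky-odd b)

gap-lowerBlock : ∀ ℓ → gap ℓ ≡ kentucky (suc (lowerBlock ℓ))
gap-lowerBlock ℓ = gap-lowerBlock-at (bin ℓ)

InRange : ℕ → ℕ → Set
InRange N ℓ = 1 ≤ ℓ × ℓ ≤ N

widen-range : ∀ {M N ℓ} → M ≤ N → InRange M ℓ → InRange N ℓ
widen-range M≤N (1≤ℓ , ℓ≤M) = 1≤ℓ , ≤-trans ℓ≤M M≤N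

widen : ∀ {a M N m} → M ≤ N → HasLegalDecomp a M m → HasLegalDecomp a N m
widen M≤N (ls , (inRange , linked) , sum≡m) =
  ls , (All.map (widen-range M≤N) inRange , linked) , sum≡m

linked-∷ʳ : ∀ {R : ℕ → ℕ → Set} {y} xs → Linked R xs → All (λ x → R x y) xs → Linked R (xs ++ y ∷ [])
linked-∷ʳ []               _            _            = [-]
linked-∷ʳ (x ∷ [])         _            (r ∷ [])     = r ∷ [-]
linked-∷ʳ (x ∷ x' ∷ xs)    (r ∷ linked) (_ ∷ rs)     = r ∷ linked-∷ʳ (x' ∷ xs) linked rs

append-top : ∀ {a r} ℓ → 1 ≤ ℓ → HasLegalDecomp a (lowerBlock ℓ) r → HasLegalDecomp a ℓ (r + a ℓ)
append-top {a} {r} ℓ 1≤ℓ (ls , (inRange , linked) , sum≡r) =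
  ls ++ ℓ ∷ [] ,
  (All.++⁺ (All.map (widen-range L≤ℓ) inRange) ((1≤ℓ , ≤-refl) ∷ []) ,
   linked-∷ʳ ls linked (All.map (λ (p , q) → lowerBlock-separated ℓ p q) inRange)) ,
  sum-eq
  where
  L≤ℓ : lowerBlock ℓ ≤ ℓ
  L≤ℓ = <⇒≤ (lowerBlock-< ℓ 1≤ℓ)
  sum-eq : sum (map a (ls ++ ℓ ∷ [])) ≡ r + a ℓ
  sum-eq = begin
    sum (map a (ls ++ ℓ ∷ []))     ≡⟨ cong sum (map-++ a ls (ℓ ∷ [])) ⟩
    sum (map a ls ++ a ℓ ∷ [])     ≡⟨ sum-++ (map a ls) (a ℓ ∷ []) ⟩
    sum (map a ls) + (a ℓ + 0)     ≡⟨ cong₂ _+_ sum≡r (+-identityʳ (a ℓ)) ⟩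
    r + a ℓ                        ∎
    where open ≡-Reasoning

Agree : (ℕ → ℕ) → (ℕ → ℕ) → ℕ → Set
Agree s t N = ∀ {ℓ} → InRange N ℓ → s ℓ ≡ t ℓ

transfer : ∀ {s t N m} → Agree s t N → HasLegalDecomp s N m → HasLegalDecomp t N m
transfer {s} {t} agree (ls , (inRange , linked) , sum≡m) =
  ls , (inRange , linked) , trans (sym (sum-agree ls inRange)) sum≡m
  where
  sum-agree : ∀ ls → All (InRange _) ls → sum (map s ls) ≡ sum (map t ls)
  sum-agree []       []             = refl
  sum-agree (ℓ ∷ ls) (ℓ∈ ∷ inRange) = cong₂ _+_ (agree ℓ∈) (sum-agree ls inRange)

-- Stronger invariant for the induction: even with the smallest summand a_ℓ
-- raised to a_{ℓ+1}, the sum stays at most a_{N+1}.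
sound-from : ∀ N ℓ rest → All (InRange N) (ℓ ∷ rest) → Linked Separated (ℓ ∷ rest) →
  kentucky (suc ℓ) + sum (map kentucky rest) ≤ kentucky (suc N)
sound-from N ℓ [] ((_ , ℓ≤N) ∷ []) _ =
  ≤-trans (≤-reflexive (+-identityʳ _)) (kentucky-mono (s≤s ℓ≤N))
sound-from N ℓ (ℓ' ∷ rest) (_ ∷ inRange) ((_ , far) ∷ linked) = begin
  kentucky (suc ℓ) + (kentucky ℓ' + S)  ≡⟨ +-assoc (kentucky (suc ℓ)) _ _ ⟨
  (kentucky (suc ℓ) + kentucky ℓ') + S  ≤⟨ +-monoˡ-≤ S (+-monoˡ-≤ (kentucky ℓ') (kentucky-below-gap {ℓ} {ℓ'} far)) ⟩
  (gap ℓ' + kentucky ℓ') + S            ≡⟨ cong (_+ S) (+-comm (gap ℓ') _) ⟩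
  kentucky (suc ℓ') + S                 ≤⟨ sound-from N ℓ' rest inRange linked ⟩
  kentucky (suc N)                      ∎
  where
  open ≤-Reasoning
  S = sum (map kentucky rest)

sound : ∀ N ls → LegalIndices N ls → sum (map kentucky ls) < kentucky (suc N)
sound N []         _                   = kentucky-pos N
sound N (ℓ ∷ rest) (inRange , linked) =
  <-≤-trans (+-monoˡ-< (sum (map kentucky rest)) (m<m+n (kentucky ℓ) (oddTerm-pos (bin ℓ ∸ 1))))
            (sound-from N ℓ rest inRange linked)

next-not-representable : ∀ N → ¬ HasLegalDecomp kentucky N (kentucky (suc N))
next-not-representable N (ls , legal , sum≡) = <-irrefl sum≡ (sound N ls legal)

Representable : ℕ → Set
Representable M = ∀ m → m < kentucky (suc M) → HasLegalDecomp kentucky M m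

complete : ∀ M → Representable M
complete = <-rec Representable greedy
  where
  greedy : ∀ M → (∀ {M'} → M' < M → Representable M') → Representable M
  greedy zero    _   zero    _          = [] , ([] , []) , refl
  greedy zero    _   (suc m) (s≤s ())
  greedy (suc n) rec m       m<next with m <? kentucky (suc n)
  ... | yes m<top = widen (n≤1+n n) (rec (n<1+n n) m m<top)
  ... | no  m≮top =
    subst (HasLegalDecomp kentucky (suc n)) (m∸n+n≡m top≤m)
      (append-top (suc n) (s≤s z≤n) (rec (lowerBlock-< (suc n) (s≤s z≤n)) (m ∸ top) remainder<))
    where
    top = kentucky (suc n)
    top≤m : top ≤ m
    top≤m = ≮⇒≥ m≮top
    remainder< : m ∸ top < kentucky (suc (lowerBlock (suc n)))
    remainder< = subst (m ∸ top <_) (trans (m+n∸m≡n top (gap (suc n))) (gap-lowerBlock (suc n)))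
                   (∸-monoˡ-< m<next top≤m)

-- The greedy rule and the agreement on 1..N pin down a_{N+1}: a smaller value
-- would be representable (completeness), a larger one would make a_{N+1} so.
next-term : ∀ {a} → IsKentucky2 a → ∀ N → 1 ≤ N → Agree a kentucky N → a (suc N) ≡ kentucky (suc N)
next-term {a} (_ , greedy) N 1≤N agree
  with greedy N 1≤N | <-cmp (a (suc N)) (kentucky (suc N))
... | _ | tri≈ _ eq _ = eq
... | _ , unrepresentable , _ | tri< lt _ _ =
  ⊥-elim (unrepresentable (transfer (λ ℓ∈ → sym (agree ℓ∈)) (complete N (a (suc N)) lt)))
... | _ , _ , representable | tri> _ _ gt =
  ⊥-elim (next-not-representable N (transfer agree (representable _ (kentucky-pos N) gt)))

kentucky-unique : ∀ {a} → IsKentucky2 a → ∀ N → Agree a kentucky (suc N)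
kentucky-unique (a₁ , _) zero (1≤ℓ , ℓ≤1) with ≤-antisym ℓ≤1 1≤ℓ
... | refl = a₁
kentucky-unique K (suc N) (1≤ℓ , ℓ≤N+2) with m≤n⇒m<n∨m≡n ℓ≤N+2
... | inj₁ (s≤s ℓ≤N+1) = kentucky-unique K N (1≤ℓ , ℓ≤N+1)
... | inj₂ refl        = next-term K (suc N) (s≤s z≤n) (kentucky-unique K N)

theorem1p1 : (a : ℕ → ℕ) → IsKentucky2 a →
    (a 1 ≡ 1 × a 2 ≡ 2 × a 3 ≡ 3 × a 4 ≡ 4 ×
    (∀ n → 4 ≤ n → a (suc n) ≡ a (n ∸ 1) + 2 * a (n ∸ 3))) ×
    (∀ n → 1 ≤ n →
    a (2 * n) ≡ 2 ^ n ×
    + (3 * a (2 * n ∸ 1)) ≡ + (2 ^ (suc n)) +ℤ (-1ℤ ^ℤ n))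
theorem1p1 a K = (proj₁ K , agrees 1 , agrees 2 , agrees 3 , recurrence) , closed-forms
  where
  agrees : ∀ ℓ → a (suc ℓ) ≡ kentucky (suc ℓ)
  agrees ℓ = kentucky-unique K ℓ (s≤s z≤n , ≤-refl)

  recurrence : ∀ n → 4 ≤ n → a (suc n) ≡ a (n ∸ 1) + 2 * a (n ∸ 3)
  recurrence _ (s≤s (s≤s (s≤s (s≤s {n = m} _)))) =
    trans (agrees (4 + m))
      (trans (kentucky-recurrence m) (sym (cong₂ (λ x y → x + 2 * y) (agrees (2 + m)) (agrees m))))

  closed-forms : ∀ n → 1 ≤ n → a (2 * n) ≡ 2 ^ n × + (3 * a (2 * n ∸ 1)) ≡ + (2 ^ (suc n)) +ℤ (-1ℤ ^ℤ n)
  closed-forms (suc j) _ =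
    trans (cong a (sym (dbl≡2* (suc j)))) (trans (agrees (suc (dbl j))) (kentucky-even j)) ,
    trans (cong (λ ℓ → + (3 * a (ℓ ∸ 1))) (sym (dbl≡2* (suc j))))
      (trans (cong (λ x → + (3 * x)) (trans (agrees (dbl j)) (kentucky-odd j))) (oddTerm-closed (suc j)))
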